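{- Let $n>1$ be an integer and $\emptyset\ne T\subseteq[n-1]$ with $t:=\max(T)\le\frac n2$. Then $\alpha(\Gamma(n,T))=\binom{n-1}{t-1}\cdot|V\Gamma(t,T\setminus\{t\})|$.
   Context: $[n]=\{1,\dots,n\}$. For a non-empty finite set $M$, a flag of $M$ is a set $f$ of non-empty proper subsets of $M$, any two comparable under inclusion; its type is $\{|X|:X\in f\}$. Subsets $X,Y$ of $M$ are in general position if $X\cup Y=M$ or $X\cap Y=\emptyset$; flags $f,f'$ are in general position if all $X\in f$, $X'\in f'$ are. $\Gamma(m,T)$ is the graph on the flags of $[m]$ of type $T$ with adjacency = general position; $V\Gamma$ is its vertex set and $\alpha(\Gamma)$ its independence number. In particular $\Gamma(t,\emptyset)$ has exactly one vertex (the empty flag). -}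

module Defs where

open import Data.Nat using (ℕ; _≤_; _*_; _≟_)
open import Data.Nat.Combinatorics using (_C_)
open import Data.Fin.Subset using (Subset; _⊂_; _∪_; _∩_; ∣_∣; Nonempty; ⊤; ⊥)
open import Data.List using (List; length; filter)
open import Data.List.Membership.Propositional using (_∈_)
open import Data.List.Relation.Unary.Any using (Any)
open import Data.List.Relation.Unary.All using (All)
open import Data.List.Relation.Unary.AllPairs using (AllPairs)
open import Data.List.Relation.Unary.Linked using (Linked)
open import Data.List.Relation.Unary.Unique.Propositional using (Unique)
open import Data.Product using (Σ; _×_)
open import Data.Sum using (_⊎_)
open import Relation.Binary.PropositionalEquality using (_≡_; _≢_)
open import Relation.Nullary using (¬_; ¬?)
open import Function.Bundles using (_⇔_)

-- A flag of [m] is a set of non-empty proper subsets, pairwise comparable.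
-- Since such a set is a chain, it has a unique representation as a list
-- that is strictly increasing under inclusion; we use that canonical form.
NonEmptyProper : {m : ℕ} → Subset m → Set
NonEmptyProper X = Nonempty X × X ≢ ⊤

IsFlag : (m : ℕ) → List (Subset m) → Set
IsFlag m f = All NonEmptyProper f × Linked _⊂_ f

HasType : {m : ℕ} → List (Subset m) → List ℕ → Set
HasType f T = (k : ℕ) → (k ∈ T) ⇔ Any (λ X → ∣ X ∣ ≡ k) f

IsVertex : (m : ℕ) → List ℕ → List (Subset m) → Set
IsVertex m T f = IsFlag m f × HasType f T

GenPosSet : {m : ℕ} → Subset m → Subset m → Set
GenPosSet X Y = (X ∪ Y ≡ ⊤) ⊎ (X ∩ Y ≡ ⊥)

GenPos : {m : ℕ} → List (Subset m) → List (Subset m) → Set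
GenPos f g = All (λ X → All (λ Y → GenPosSet X Y) g) f

IsIndependent : (m : ℕ) → List ℕ → List (List (Subset m)) → Set
IsIndependent m T I =
  Unique I × All (IsVertex m T) I × AllPairs (λ f g → ¬ GenPos f g) I

IndependenceNumberIs : (m : ℕ) → List ℕ → ℕ → Set
IndependenceNumberIs m T N =
  Σ (List (List (Subset m))) (λ I → IsIndependent m T I × length I ≡ N)
  × ((I : List (List (Subset m))) → IsIndependent m T I → length I ≤ N)

VertexCountIs : (m : ℕ) → List ℕ → ℕ → Set
VertexCountIs m T c =
  Σ (List (List (Subset m))) (λ L →
    Unique L × All (IsVertex m T) L
    × ((f : List (Subset m)) → IsVertex m T f → f ∈ L)
    × length L ≡ c)

remove : ℕ → List ℕ → List ℕ
remove t T = filter (λ k → ¬? (k ≟ t)) T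

-- A vertex of Γ(n, T) is a flag whose largest member X has size t = max T, and the flags with a
-- given top X correspond, by reading the rest of the flag inside X, to the vertices of
-- Γ(t, T \ {t}); let c be their number. Flags with disjoint tops are in general position, so the
-- tops of an independent set form an intersecting family of t-subsets of [n], which by the
-- Erdős–Ko–Rado theorem (2t ≤ n; proved by shifting) has at most C(n-1, t-1) members; hence
-- α ≤ C(n-1, t-1) · c. Conversely the C(n-1, t-1) · c flags whose top contains a fixed point are
-- pairwise not in general position: two such tops meet, and since 2t ≤ n they do not cover [n].

module Submission where

open import Defs
open import Data.Bool using (Bool; true; false; _∧_; _∨_; not; if_then_else_)
import Data.Bool as Bool
open import Data.Empty using (⊥-elim)
open import Data.Fin using (Fin; zero; suc)
open import Data.Fin.Properties using (any?) renaming (_≟_ to _≟ᶠ_)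
open import Data.Fin.Subset using (Subset; inside; outside; ∣_∣; ∁; _∪_; _∩_; _⊆_; _⊂_; ⊤; ⊥; Nonempty)
open import Data.Fin.Subset.Properties
  using (∣∁p∣≡n∸∣p∣; ⊆-refl; ⊆-trans; ⊂-trans; drop-∷-⊆; out⊆; in⊆in; ⊆⊤; p⊂q⇒p⊆q; ∣p∣≤n; ∣p∣≡n⇒p≡⊤; ∣⊤∣≡n;
         p⊆q⇒∣p∣≤∣q∣; p⊂q⇒∣p∣<∣q∣; nonempty?; _⊂?_;
         Empty-unique; x∈p∩q⁻; ∣⊥∣≡0)
open import Data.Nat using (ℕ; zero; suc; _+_; _*_; _∸_; _≤_; _<_; z≤n; s≤s; s≤s⁻¹)
open import Data.Nat.Combinatorics using (_C_; nCk+nC[k+1]≡[n+1]C[k+1])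
open import Data.Nat.Induction using (<-wellFounded)
open import Data.Nat.Properties
open import Algebra.Properties.CommutativeSemigroup +-commutativeSemigroup
  using () renaming (interchange to +-interchange)
open import Data.Product using (Σ; ∃; _×_; _,_; proj₁; proj₂)
import Data.Product as Product
open import Data.Sum using (_⊎_; inj₁; inj₂)
open import Data.Vec using ([]; _∷_; lookup; _[_]≔_; here; there)
open import Data.Vec.Properties
  using (≡-dec; ∷-injectiveʳ; []=⇒lookup; lookup⇒[]=; lookup∘update; lookup∘update′; []≔-idempotent; []≔-lookup;
         lookup-map)
open import Data.List
  using (List; []; _∷_; _++_; _∷ʳ_; [_]; length; map; filter; cartesianProductWith; deduplicate)
import Data.List.Properties as List
open import Data.List.Properties using (filter-none; length-++-sucʳ; map-∘; map-cong; map-id; map-id-local)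
open import Data.List.Membership.Propositional using (_∈_; find; lose)
open import Data.List.Membership.DecPropositional _≟_ using (_∈?_)
open import Data.List.Membership.Propositional.Properties
  using (∈-∃++; ∈-++⁻; ∈-++⁺ˡ; ∈-++⁺ʳ; ∈-filter⁺; ∈-filter⁻; ∈-map⁺; ∈-map⁻; ∈-cartesianProductWith⁺;
         ∈-deduplicate⁺)
open import Data.List.Relation.Unary.Any using (Any; here; there)
import Data.List.Relation.Unary.Any as Any
open import Data.List.Relation.Unary.All using (All; []; _∷_)
import Data.List.Relation.Unary.All as All
import Data.List.Relation.Unary.All.Properties as All
open import Data.List.Relation.Unary.AllPairs using (AllPairs; []; _∷_)
import Data.List.Relation.Unary.AllPairs as AllPairs
import Data.List.Relation.Unary.AllPairs.Properties as AllPairs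
open import Data.List.Relation.Unary.Linked using (Linked; []; [-]; _∷_; linked?)
open import Data.List.Relation.Unary.Linked.Properties using (Linked⇒AllPairs; AllPairs⇒Linked)
open import Data.List.Relation.Unary.Unique.Propositional using (Unique)
import Data.List.Relation.Unary.Unique.Propositional.Properties as Unique
open import Data.List.Relation.Unary.Unique.DecPropositional.Properties using (deduplicate-!)
open import Function using (_∘_; id; case_of_)
open import Function.Bundles using (Equivalence; mk⇔; _⇔_)
open import Induction.WellFounded using (Acc; acc)
open import Relation.Binary.PropositionalEquality hiding ([_])
open import Relation.Binary.Definitions using (DecidableEquality)
open import Relation.Nullary using (¬_; ¬?; Dec; yes; no; does)
open import Relation.Nullary.Decidable using (_×-dec_; dec-true)
import Relation.Nullary.Decidable as Dec
open import Relation.Unary using (Decidable)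

-- Sums over all subsets of [n]

𝟙 : Bool → ℕ
𝟙 true  = 1
𝟙 false = 0

∑ : (n : ℕ) → (Subset n → ℕ) → ℕ
∑ zero    h = h []
∑ (suc n) h = ∑ n (h ∘ (outside ∷_)) + ∑ n (h ∘ (inside ∷_))

∑-cong : ∀ n {g h : Subset n → ℕ} → (∀ X → g X ≡ h X) → ∑ n g ≡ ∑ n h
∑-cong zero    g≡h = g≡h []
∑-cong (suc n) g≡h = cong₂ _+_ (∑-cong n (g≡h ∘ _)) (∑-cong n (g≡h ∘ _))

∑-mono-≤ : ∀ n {g h : Subset n → ℕ} → (∀ X → g X ≤ h X) → ∑ n g ≤ ∑ n h
∑-mono-≤ zero    g≤h = g≤h []
∑-mono-≤ (suc n) g≤h = +-mono-≤ (∑-mono-≤ n (g≤h ∘ _)) (∑-mono-≤ n (g≤h ∘ _))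

∑-zero : ∀ n → ∑ n (λ _ → 0) ≡ 0
∑-zero zero    = refl
∑-zero (suc n) = cong₂ _+_ (∑-zero n) (∑-zero n)

∑-+ : ∀ n (g h : Subset n → ℕ) → ∑ n (λ X → g X + h X) ≡ ∑ n g + ∑ n h
∑-+ zero    g h = refl
∑-+ (suc n) g h =
  trans (cong₂ _+_ (∑-+ n _ _) (∑-+ n _ _)) (+-interchange (∑ n _) (∑ n _) (∑ n _) (∑ n _))

∑-*ʳ : ∀ n (g : Subset n → ℕ) c → ∑ n (λ X → g X * c) ≡ ∑ n g * c
∑-*ʳ zero    g c = refl
∑-*ʳ (suc n) g c =
  trans (cong₂ _+_ (∑-*ʳ n _ c) (∑-*ʳ n _ c)) (sym (*-distribʳ-+ c (∑ n _) (∑ n _)))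

∑≡0⇒≡0 : ∀ n (h : Subset n → ℕ) → ∑ n h ≡ 0 → ∀ X → h X ≡ 0
∑≡0⇒≡0 zero    h ∑h≡0 []            = ∑h≡0
∑≡0⇒≡0 (suc n) h ∑h≡0 (outside ∷ X) = ∑≡0⇒≡0 n _ (m+n≡0⇒m≡0 _ ∑h≡0) X
∑≡0⇒≡0 (suc n) h ∑h≡0 (inside ∷ X)  = ∑≡0⇒≡0 n _ (m+n≡0⇒n≡0 _ ∑h≡0) X

∑-∁ : ∀ n (h : Subset n → ℕ) → ∑ n (h ∘ ∁) ≡ ∑ n h
∑-∁ zero    h = refl
∑-∁ (suc n) h = trans (cong₂ _+_ (∑-∁ n _) (∑-∁ n _)) (+-comm (∑ n _) (∑ n _))

∑-size : ∀ n k → ∑ n (λ X → 𝟙 (does (∣ X ∣ ≟ k))) ≡ n C k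
∑-size zero    zero    = refl
∑-size zero    (suc k) = refl
∑-size (suc n) zero    = cong₂ _+_ (∑-size n zero) (∑-zero n)
∑-size (suc n) (suc k) = begin
  ∑ n (λ X → 𝟙 (does (∣ X ∣ ≟ suc k))) + ∑ n (λ X → 𝟙 (does (∣ X ∣ ≟ k)))
    ≡⟨ cong₂ _+_ (∑-size n (suc k)) (∑-size n k) ⟩
  n C suc k + n C k  ≡⟨ +-comm (n C suc k) (n C k) ⟩
  n C k + n C suc k  ≡⟨ nCk+nC[k+1]≡[n+1]C[k+1] n k ⟩
  suc n C suc k      ∎
  where open ≡-Reasoning

∑-reindex-unset : ∀ n (j : Fin n) (h : Subset n → ℕ) →
  ∑ n (λ X → if lookup X j then h (X [ j ]≔ outside) else 0) ≡ ∑ n (λ X → if lookup X j then 0 else h X)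
∑-reindex-unset (suc n) zero    h =
  trans (cong (_+ ∑ n (h ∘ (outside ∷_))) (∑-zero n))
    (sym (trans (cong (∑ n (h ∘ (outside ∷_)) +_) (∑-zero n)) (+-identityʳ _)))
∑-reindex-unset (suc n) (suc j) h = cong₂ _+_ (∑-reindex-unset n j _) (∑-reindex-unset n j _)

_≟ˢ_ : ∀ {n} → DecidableEquality (Subset n)
_≟ˢ_ = ≡-dec Bool._≟_

∑-point : ∀ n (Y : Subset n) → ∑ n (λ X → 𝟙 (does (Y ≟ˢ X))) ≡ 1
∑-point zero    []            = refl
∑-point (suc n) (outside ∷ Y) = trans (cong (_+ ∑ n (λ _ → 0)) (∑-point n Y)) (cong suc (∑-zero n))
∑-point (suc n) (inside ∷ Y)  = cong₂ _+_ (∑-zero n) (∑-point n Y)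

∧-true⁻ : ∀ {a b} → a ∧ b ≡ true → a ≡ true × b ≡ true
∧-true⁻ {true} b≡true = refl , b≡true

𝟙-not≡0 : ∀ {b} → 𝟙 (not b) ≡ 0 → b ≡ true
𝟙-not≡0 {true} _ = refl

≡𝟙[does]* : ∀ {p} {A : Set p} (a? : Dec A) {x c} → (A → x ≡ c) → (¬ A → x ≡ 0) → x ≡ 𝟙 (does a?) * c
≡𝟙[does]* (yes a) if-yes _     = trans (if-yes a) (sym (+-identityʳ _))
≡𝟙[does]* (no ¬a) _      if-no = if-no ¬a

𝟙-does⁺ : ∀ {p} {A : Set p} (a? : Dec A) → A → 1 ≤ 𝟙 (does a?)
𝟙-does⁺ a? a = ≤-reflexive (cong 𝟙 (sym (dec-true a? a)))

∣unset∣ : ∀ {n} (X : Subset n) j → lookup X j ≡ inside → suc ∣ X [ j ]≔ outside ∣ ≡ ∣ X ∣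
∣unset∣ (inside ∷ X)  zero    _   = refl
∣unset∣ (inside ∷ X)  (suc j) j∈X = cong suc (∣unset∣ X j j∈X)
∣unset∣ (outside ∷ X) (suc j) j∈X = ∣unset∣ X j j∈X

set-unset : ∀ {n} (X : Subset n) j → lookup X j ≡ inside → (X [ j ]≔ outside) [ j ]≔ inside ≡ X
set-unset X j j∈X = trans ([]≔-idempotent X j) (trans (cong (X [ j ]≔_) (sym j∈X)) ([]≔-lookup X j))

lookup-unset : ∀ {n} (X : Subset n) j k → lookup (X [ j ]≔ outside) k ≡ inside → k ≢ j × lookup X k ≡ inside
lookup-unset X j k k∈X′ with k ≟ᶠ j
... | yes refl with () ← trans (sym (lookup∘update j X outside)) k∈X′
... | no k≢j = k≢j , trans (sym (lookup∘update′ k≢j X outside)) k∈X′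

∣p∪q∣≤∣p∣+∣q∣ : ∀ {n} (p q : Subset n) → ∣ p ∪ q ∣ ≤ ∣ p ∣ + ∣ q ∣
∣p∪q∣≤∣p∣+∣q∣ []            []            = z≤n
∣p∪q∣≤∣p∣+∣q∣ (inside ∷ p)  (inside ∷ q)  = s≤s (≤-trans (∣p∪q∣≤∣p∣+∣q∣ p q) (+-monoʳ-≤ ∣ p ∣ (n≤1+n _)))
∣p∪q∣≤∣p∣+∣q∣ (inside ∷ p)  (outside ∷ q) = s≤s (∣p∪q∣≤∣p∣+∣q∣ p q)
∣p∪q∣≤∣p∣+∣q∣ (outside ∷ p) (inside ∷ q)  = ≤-trans (s≤s (∣p∪q∣≤∣p∣+∣q∣ p q)) (≤-reflexive (sym (+-suc _ _)))
∣p∪q∣≤∣p∣+∣q∣ (outside ∷ p) (outside ∷ q) = ∣p∪q∣≤∣p∣+∣q∣ p q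

∣p∣<n⇒∃outside : ∀ {n} (p : Subset n) → ∣ p ∣ < n → ∃ λ j → lookup p j ≡ outside
∣p∣<n⇒∃outside (outside ∷ p) _          = zero , refl
∣p∣<n⇒∃outside (inside ∷ p)  (s≤s ∣p∣<n) with j , j∉p ← ∣p∣<n⇒∃outside p ∣p∣<n = suc j , j∉p

lookup-∪-outside : ∀ {n} (p q : Subset n) j → lookup (p ∪ q) j ≡ outside →
  lookup p j ≡ outside × lookup q j ≡ outside
lookup-∪-outside (outside ∷ p) (outside ∷ q) zero    _ = refl , refl
lookup-∪-outside (_ ∷ p)       (_ ∷ q)       (suc j) j∉p∪q = lookup-∪-outside p q j j∉p∪q

lookup⇒0<∣p∣ : ∀ {n} (p : Subset n) i → lookup p i ≡ inside → 0 < ∣ p ∣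
lookup⇒0<∣p∣ (inside ∷ p)  _       _   = s≤s z≤n
lookup⇒0<∣p∣ (outside ∷ p) (suc i) i∈p = lookup⇒0<∣p∣ p i i∈p

2+∣p∪q∣≤2t : ∀ {n s} (p q : Subset n) → ∣ p ∣ ≡ s → ∣ q ∣ ≡ s → 2 + ∣ p ∪ q ∣ ≤ 2 * suc s
2+∣p∪q∣≤2t {s = s} p q ∣p∣≡s ∣q∣≡s = begin
  2 + ∣ p ∪ q ∣       ≤⟨ +-monoʳ-≤ 2 (∣p∪q∣≤∣p∣+∣q∣ p q) ⟩
  2 + (∣ p ∣ + ∣ q ∣) ≡⟨ cong (2 +_) (cong₂ _+_ ∣p∣≡s ∣q∣≡s) ⟩
  2 + (s + s)         ≡⟨ cong suc (+-suc s s) ⟨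
  suc s + suc s       ≡⟨ cong (suc s +_) (+-identityʳ (suc s)) ⟨
  2 * suc s           ∎
  where open ≤-Reasoning

⊆∧≢⇒⊂ : ∀ {n} {p q : Subset n} → p ⊆ q → p ≢ q → p ⊂ q
⊆∧≢⇒⊂ {p = []}    {[]}    _   p≢q = ⊥-elim (p≢q refl)
⊆∧≢⇒⊂ {p = x ∷ p} {y ∷ q} p⊆q p≢q with p ≟ˢ q
... | no p′≢q′ with p′⊆q′ , i , i∈q , i∉p ← ⊆∧≢⇒⊂ (drop-∷-⊆ p⊆q) p′≢q′ =
  p⊆q , suc i , there i∈q , λ { (there i∈p) → i∉p i∈p }
... | yes refl with x | y | p⊆q
...   | outside | outside | _   = ⊥-elim (p≢q refl)
...   | inside  | inside  | _   = ⊥-elim (p≢q refl)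
...   | outside | inside  | x⊆y = x⊆y , zero , here , λ ()
...   | inside  | outside | x⊆y with () ← x⊆y here

⊂⇒≢ : ∀ {n} {p q : Subset n} → p ⊂ q → p ≢ q
⊂⇒≢ (_ , i , i∈q , i∉p) refl = i∉p i∈q

NonEmptyProper⇒∣∣ : ∀ {n} {p : Subset n} → NonEmptyProper p → 0 < ∣ p ∣ × ∣ p ∣ < n
NonEmptyProper⇒∣∣ {n} {p} ((i , i∈p) , p≢⊤) =
  lookup⇒0<∣p∣ p i ([]=⇒lookup i∈p) , ≤∧≢⇒< (∣p∣≤n p) (p≢⊤ ∘ ∣p∣≡n⇒p≡⊤)

∣∣⇒NonEmptyProper : ∀ {n} (p : Subset n) → 0 < ∣ p ∣ → ∣ p ∣ < n → NonEmptyProper p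
∣∣⇒NonEmptyProper p 0<∣p∣ ∣p∣<n = nonempty p 0<∣p∣ , λ { refl → <-irrefl (∣⊤∣≡n _) ∣p∣<n }
  where
  nonempty : ∀ {n} (p : Subset n) → 0 < ∣ p ∣ → Nonempty p
  nonempty (inside ∷ p)  _ = zero , here
  nonempty (outside ∷ p) 0<∣p∣ with i , i∈p ← nonempty p 0<∣p∣ = suc i , there i∈p

-- Erdős–Ko–Rado by shifting

Family : ℕ → Set
Family n = Subset n → Bool

size : ∀ {n} → Family n → ℕ
size {n} P = ∑ n (𝟙 ∘ P)

Uniform : ∀ {n} → Family n → ℕ → Set
Uniform P k = ∀ A → P A ≡ true → ∣ A ∣ ≡ k

Meets : ∀ {n} → Subset n → Subset n → Set
Meets A B = ∃ λ i → lookup A i ≡ inside × lookup B i ≡ inside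

Intersecting : ∀ {n} → Family n → Set
Intersecting P = ∀ A B → P A ≡ true → P B ≡ true → Meets A B

Meets-sym : ∀ {n} {A B : Subset n} → Meets A B → Meets B A
Meets-sym (i , i∈A , i∈B) = i , i∈B , i∈A

degree₀ : ∀ {m} → Family (suc m) → ℕ
degree₀ P = size (P ∘ (inside ∷_))

-- The (0, j+1)-shift: a member A ∋ 0 with j+1 ∉ A is replaced by A - 0 + (j+1), unless
-- that set already belongs to P.
module Shift {m : ℕ} (j : Fin m) (P : Family (suc m)) where

  shift : Family (suc m)
  shift (inside ∷ X)  =
    if lookup X j then P (inside ∷ X) else P (inside ∷ X) ∧ P (outside ∷ X [ j ]≔ inside)
  shift (outside ∷ X) =
    if lookup X j then P (outside ∷ X) ∨ P (inside ∷ X [ j ]≔ outside) else P (outside ∷ X)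

  movable : Subset m → ℕ
  movable X = 𝟙 (P (inside ∷ X) ∧ not (P (outside ∷ X [ j ]≔ inside)))

  moved : Subset m → ℕ
  moved X = if lookup X j then 0 else movable X

  shift-inside : ∀ X → 𝟙 (shift (inside ∷ X)) + moved X ≡ 𝟙 (P (inside ∷ X))
  shift-inside X with lookup X j
  ... | inside = +-identityʳ _
  ... | outside with P (inside ∷ X) | P (outside ∷ X [ j ]≔ inside)
  ...   | true  | true  = refl
  ...   | true  | false = refl
  ...   | false | _     = refl

  shift-outside : ∀ X →
    𝟙 (shift (outside ∷ X)) ≡ 𝟙 (P (outside ∷ X)) + (if lookup X j then movable (X [ j ]≔ outside) else 0)
  shift-outside X with lookup X j in j∈X
  ... | outside = sym (+-identityʳ _)
  ... | inside rewrite set-unset X j j∈X with P (outside ∷ X) | P (inside ∷ X [ j ]≔ outside)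
  ...   | true  | true  = refl
  ...   | true  | false = refl
  ...   | false | true  = refl
  ...   | false | false = refl

  degree₀-shift : degree₀ shift + ∑ m moved ≡ degree₀ P
  degree₀-shift = trans (sym (∑-+ m _ moved)) (∑-cong m shift-inside)

  size-shift : size shift ≡ size P
  size-shift = begin
    size (shift ∘ (outside ∷_)) + degree₀ shift
      ≡⟨ cong (_+ degree₀ shift) (trans (∑-cong m shift-outside) (∑-+ m _ _)) ⟩
    (size (P ∘ (outside ∷_)) + ∑ m (λ X → if lookup X j then movable (X [ j ]≔ outside) else 0)) + degree₀ shift
      ≡⟨ cong (λ z → (size (P ∘ (outside ∷_)) + z) + degree₀ shift) (∑-reindex-unset m j movable) ⟩
    (size (P ∘ (outside ∷_)) + ∑ m moved) + degree₀ shift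
      ≡⟨ +-assoc (size (P ∘ (outside ∷_))) _ _ ⟩
    size (P ∘ (outside ∷_)) + (∑ m moved + degree₀ shift)
      ≡⟨ cong (size (P ∘ (outside ∷_)) +_) (trans (+-comm (∑ m moved) _) degree₀-shift) ⟩
    size P ∎
    where open ≡-Reasoning

  shift-inside⁻ : ∀ X → shift (inside ∷ X) ≡ true →
    P (inside ∷ X) ≡ true × (lookup X j ≡ outside → P (outside ∷ X [ j ]≔ inside) ≡ true)
  shift-inside⁻ X A∈ with lookup X j
  ... | inside  = A∈ , λ ()
  ... | outside = proj₁ (∧-true⁻ A∈) , λ _ → proj₂ (∧-true⁻ A∈)

  shift-outside⁻ : ∀ X → shift (outside ∷ X) ≡ true →
    P (outside ∷ X) ≡ true ⊎ (lookup X j ≡ inside × P (inside ∷ X [ j ]≔ outside) ≡ true)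
  shift-outside⁻ X A∈ with lookup X j
  ... | outside = inj₁ A∈
  ... | inside with P (outside ∷ X)
  ...   | true  = inj₁ refl
  ...   | false = inj₂ (refl , A∈)

  shift-uniform : ∀ {k} → Uniform P k → Uniform shift k
  shift-uniform U (inside ∷ X) A∈ = U _ (proj₁ (shift-inside⁻ X A∈))
  shift-uniform U (outside ∷ X) A∈ with lookup X j in j∈X | shift-outside⁻ X A∈
  ... | _      | inj₁ A∈P        = U _ A∈P
  ... | inside | inj₂ (_ , A′∈P) = trans (sym (∣unset∣ X j j∈X)) (U _ A′∈P)

  module _ (I : Intersecting P) where

    meets-inside-outside : ∀ X Y → shift (inside ∷ X) ≡ true → shift (outside ∷ Y) ≡ true →
      Meets (inside ∷ X) (outside ∷ Y)
    meets-inside-outside X Y A∈ B∈ with shift-inside⁻ X A∈ | shift-outside⁻ Y B∈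
    ... | A∈P , _ | inj₁ B∈P = I _ _ A∈P B∈P
    ... | A∈P , A′∈P | inj₂ (j∈Y , B′∈P) with lookup X j in j∈X
    ...   | inside  = suc j , j∈X , j∈Y
    ...   | outside with I _ _ (A′∈P refl) B′∈P
    ...     | suc k , k∈X′ , k∈Y′ with lookup-unset Y j k k∈Y′
    ...       | k≢j , k∈Y = suc k , trans (sym (lookup∘update′ k≢j X inside)) k∈X′ , k∈Y

    shift-intersecting : Intersecting shift
    shift-intersecting (inside ∷ X)  (inside ∷ Y)  _  _  = zero , refl , refl
    shift-intersecting (inside ∷ X)  (outside ∷ Y) A∈ B∈ = meets-inside-outside X Y A∈ B∈
    shift-intersecting (outside ∷ X) (inside ∷ Y)  A∈ B∈ =
      Meets-sym {A = inside ∷ Y} {B = outside ∷ X} (meets-inside-outside Y X B∈ A∈)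
    shift-intersecting (outside ∷ X) (outside ∷ Y) A∈ B∈ with shift-outside⁻ X A∈ | shift-outside⁻ Y B∈
    ... | inj₁ A∈P          | inj₁ B∈P          = I _ _ A∈P B∈P
    ... | inj₂ (j∈X , _)    | inj₂ (j∈Y , _)    = suc j , j∈X , j∈Y
    ... | inj₂ (_ , A′∈P)   | inj₁ B∈P with I _ _ A′∈P B∈P
    ...   | suc k , k∈X′ , k∈Y = suc k , proj₂ (lookup-unset X j k k∈X′) , k∈Y
    shift-intersecting (outside ∷ X) (outside ∷ Y) A∈ B∈
        | inj₁ A∈P          | inj₂ (_ , B′∈P) with I _ _ A∈P B′∈P
    ...   | suc k , k∈X , k∈Y′ = suc k , k∈X , proj₂ (lookup-unset Y j k k∈Y′)

Shifted : ∀ {m} → Family (suc m) → Set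
Shifted {m} P =
  ∀ (j : Fin m) X → lookup X j ≡ outside → P (inside ∷ X) ≡ true → P (outside ∷ X [ j ]≔ inside) ≡ true

EKR : ℕ → Set
EKR m = ∀ s (P : Family (suc m)) → Uniform P (suc s) → Intersecting P → 2 * suc s ≤ suc m → size P ≤ m C s

EKR-shifted : ℕ → Set
EKR-shifted m = ∀ s (P : Family (suc m)) → Uniform P (suc s) → Intersecting P → Shifted P →
  2 * suc s ≤ suc m → size P ≤ m C s

-- Each effective shift lowers degree₀, so repeated shifting ends in a shifted family of the same size.
ekr-by-shifting : ∀ {m} → EKR-shifted m → EKR m
ekr-by-shifting {m} ekrˢ s P U I h = go P (<-wellFounded (degree₀ P)) U I
  where
  go : ∀ Q → Acc _<_ (degree₀ Q) → Uniform Q (suc s) → Intersecting Q → size Q ≤ m C s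
  go Q (acc rs) U I with any? (λ j → 1 ≤? ∑ m (Shift.moved j Q))
  ... | yes (j , moves) = begin
    size Q           ≡⟨ size-shift ⟨
    size shift       ≤⟨ go shift (rs (subst (degree₀ shift <_) degree₀-shift (m<m+n _ moves)))
                             (shift-uniform U) (shift-intersecting I) ⟩
    m C s            ∎
    where
    open Shift j Q
    open ≤-Reasoning
  ... | no stuck = ekrˢ s Q U I shifted h
    where
    shifted : Shifted Q
    shifted j X j∉X A∈Q = 𝟙-not≡0 (begin
      𝟙 (not (Q (outside ∷ X [ j ]≔ inside)))
        ≡⟨ cong (λ b → 𝟙 (b ∧ not (Q (outside ∷ X [ j ]≔ inside)))) A∈Q ⟨
      movable X
        ≡⟨ cong (λ b → if b then 0 else movable X) j∉X ⟨
      moved X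
        ≡⟨ ∑≡0⇒≡0 m moved (n<1⇒n≡0 (≰⇒> (λ moves → stuck (j , moves)))) X ⟩
      0 ∎)
      where
      open Shift j Q
      open ≡-Reasoning

¬Meets-∁ : ∀ {n} (X : Subset n) → ¬ Meets (outside ∷ X) (inside ∷ ∁ X)
¬Meets-∁ X (suc k , k∈X , k∈∁X) with lookup X k | lookup-map k not X
... | inside  | k∈∁X≡ = case trans (sym k∈∁X≡) k∈∁X of λ ()
... | outside | _     = case k∈X of λ ()

-- When n = 2t, a family contains at most one set of each complementary pair {A, [n] - A}.
ekr-half : ∀ m s (P : Family (suc m)) → Uniform P (suc s) → Intersecting P → suc m ≡ 2 * suc s →
  size P ≤ m C s
ekr-half m s P U I n≡2t = begin
  ∑ m (𝟙 ∘ P ∘ (outside ∷_)) + ∑ m (𝟙 ∘ P ∘ (inside ∷_))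
    ≡⟨ cong (∑ m (𝟙 ∘ P ∘ (outside ∷_)) +_) (∑-∁ m (𝟙 ∘ P ∘ (inside ∷_))) ⟨
  ∑ m (𝟙 ∘ P ∘ (outside ∷_)) + ∑ m (λ X → 𝟙 (P (inside ∷ ∁ X)))
    ≡⟨ ∑-+ m _ _ ⟨
  ∑ m (λ X → 𝟙 (P (outside ∷ X)) + 𝟙 (P (inside ∷ ∁ X)))
    ≤⟨ ∑-mono-≤ m at-most-one ⟩
  ∑ m (λ X → 𝟙 (does (∣ ∁ X ∣ ≟ s)))
    ≡⟨ ∑-∁ m (λ X → 𝟙 (does (∣ X ∣ ≟ s))) ⟩
  ∑ m (λ X → 𝟙 (does (∣ X ∣ ≟ s)))
    ≡⟨ ∑-size m s ⟩
  m C s ∎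
  where
  open ≤-Reasoning
  m≡s+t : m ≡ s + suc s
  m≡s+t = suc-injective (trans n≡2t (cong (suc s +_) (+-identityʳ (suc s))))
  at-most-one : ∀ X → 𝟙 (P (outside ∷ X)) + 𝟙 (P (inside ∷ ∁ X)) ≤ 𝟙 (does (∣ ∁ X ∣ ≟ s))
  at-most-one X with P (outside ∷ X) in A∈ | P (inside ∷ ∁ X) in B∈
  ... | true  | true  = ⊥-elim (¬Meets-∁ X (I _ _ A∈ B∈))
  ... | true  | false = 𝟙-does⁺ (∣ ∁ X ∣ ≟ s) (begin-equality
    ∣ ∁ X ∣                 ≡⟨ ∣∁p∣≡n∸∣p∣ X ⟩
    m ∸ ∣ X ∣               ≡⟨ cong₂ _∸_ m≡s+t (U _ A∈) ⟩
    s + suc s ∸ suc s       ≡⟨ m+n∸n≡m s (suc s) ⟩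
    s                       ∎)
  ... | false | true  = 𝟙-does⁺ (∣ ∁ X ∣ ≟ s) (suc-injective (U _ B∈))
  ... | false | false = z≤n

intersecting-outside : ∀ {m} {P : Family (suc m)} → Intersecting P → Intersecting (P ∘ (outside ∷_))
intersecting-outside I A B A∈ B∈ with I _ _ A∈ B∈
... | suc k , k∈A , k∈B = k , k∈A , k∈B

-- Two members through 0 avoid a common point j+1, and shifting one of them onto j+1 keeps it
-- in P, so they must already meet away from 0.
intersecting-inside : ∀ {m s} {P : Family (suc (suc m))} → Uniform P (suc s) → Intersecting P → Shifted P →
  2 * suc s ≤ suc m → Intersecting (P ∘ (inside ∷_))
intersecting-inside {m} {s} {P} U I S 2t≤m A B A∈ B∈
  with j , j∉A∪B ← ∣p∣<n⇒∃outside (A ∪ B)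
         (≤-trans (n≤1+n _) (≤-trans (2+∣p∪q∣≤2t A B (suc-injective (U _ A∈)) (suc-injective (U _ B∈))) 2t≤m))
  with j∉A , j∉B ← lookup-∪-outside A B j j∉A∪B
  with I _ _ A∈ (S j B j∉B B∈)
... | suc k , k∈A , k∈B′ with k ≟ᶠ j
...   | yes refl = case trans (sym j∉A) k∈A of λ ()
...   | no k≢j   = k , k∈A , trans (sym (lookup∘update′ k≢j B inside)) k∈B′

size-uniform₀-intersecting : ∀ {n} (P : Family n) → Uniform P 0 → Intersecting P → size P ≡ 0
size-uniform₀-intersecting {n} P U I = trans (∑-cong n empty) (∑-zero n)
  where
  empty : ∀ A → 𝟙 (P A) ≡ 0
  empty A with P A in A∈
  ... | false = refl
  ... | true with i , i∈A , _ ← I A A A∈ A∈ = case subst (0 <_) (U A A∈) (lookup⇒0<∣p∣ A i i∈A) of λ ()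

-- For n > 2t, split P by the point 0: the sets avoiding 0 form an EKR family on [n-1], and the
-- sets through 0, with 0 removed, form one for t - 1; Pascal's rule adds the two bounds.
ekr-shifted-step : ∀ {m} → EKR m → EKR-shifted (suc m)
ekr-shifted-step {m} ekr s P U I S 2t≤n with suc (suc m) ≟ 2 * suc s
... | yes n≡2t = ekr-half (suc m) s P U I n≡2t
... | no n≢2t = begin
  size (P ∘ (outside ∷_)) + size (P ∘ (inside ∷_))
    ≤⟨ +-monoˡ-≤ (size (P ∘ (inside ∷_))) (ekr s _ (U ∘ (outside ∷_)) (intersecting-outside I) 2t≤m) ⟩
  m C s + size (P ∘ (inside ∷_))
    ≤⟨ link s (λ A A∈ → suc-injective (U (inside ∷ A) A∈)) (intersecting-inside U I S 2t≤m)
         (≤-trans (*-monoʳ-≤ 2 (n≤1+n s)) 2t≤m) ⟩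
  suc m C s ∎
  where
  open ≤-Reasoning
  2t≤m : 2 * suc s ≤ suc m
  2t≤m = s≤s⁻¹ (≤∧≢⇒< 2t≤n (n≢2t ∘ sym))
  link : ∀ r → Uniform (P ∘ (inside ∷_)) r → Intersecting (P ∘ (inside ∷_)) → 2 * r ≤ suc m →
    m C r + size (P ∘ (inside ∷_)) ≤ suc m C r
  link zero U₁ I₁ _ = ≤-reflexive (cong (1 +_) (size-uniform₀-intersecting _ U₁ I₁))
  link (suc r) U₁ I₁ 2r≤m = begin
    m C suc r + size (P ∘ (inside ∷_)) ≤⟨ +-monoʳ-≤ (m C suc r) (ekr r _ U₁ I₁ 2r≤m) ⟩
    m C suc r + m C r                  ≡⟨ +-comm (m C suc r) (m C r) ⟩
    m C r + m C suc r                  ≡⟨ nCk+nC[k+1]≡[n+1]C[k+1] m r ⟩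
    suc m C suc r                      ∎

erdősKoRado : ∀ m → EKR m
erdősKoRado zero    = ekr-by-shifting λ { s _ _ _ _ (s≤s 2t≤1) → case m+n≤o⇒n≤o s 2t≤1 of λ () }
erdősKoRado (suc m) = ekr-by-shifting (ekr-shifted-step (erdősKoRado m))

length-≤-injection : ∀ {a b} {A : Set a} {B : Set b} (g : A → B) {xs : List A} {ys : List B} → Unique xs →
  (∀ {x} → x ∈ xs → g x ∈ ys) → (∀ {x y} → x ∈ xs → y ∈ xs → g x ≡ g y → x ≡ y) → length xs ≤ length ys
length-≤-injection g {[]}     _          _     _   = z≤n
length-≤-injection g {x ∷ xs} (x∉xs ∷ u) g∈ys inj with ys₁ , ys₂ , refl ← ∈-∃++ (g∈ys (here refl)) = begin
  suc (length xs)               ≤⟨ s≤s (length-≤-injection g u g∈ys₁ys₂ (λ p q → inj (there p) (there q))) ⟩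
  suc (length (ys₁ ++ ys₂))     ≡⟨ length-++-sucʳ ys₁ (g x) ys₂ ⟨
  length (ys₁ ++ g x ∷ ys₂)     ∎
  where
  open ≤-Reasoning
  g∈ys₁ys₂ : ∀ {y} → y ∈ xs → g y ∈ ys₁ ++ ys₂
  g∈ys₁ys₂ {y} y∈xs with ∈-++⁻ ys₁ (g∈ys (there y∈xs))
  ... | inj₁ gy∈ys₁        = ∈-++⁺ˡ gy∈ys₁
  ... | inj₂ (there gy∈ys₂) = ∈-++⁺ʳ ys₁ gy∈ys₂
  ... | inj₂ (here gy≡gx)   = ⊥-elim (All.lookup x∉xs y∈xs (sym (inj (there y∈xs) (here refl) gy≡gx)))

AllPairs-∈ : ∀ {a r} {A : Set a} {R : A → A → Set r} {xs x y} → AllPairs R xs → x ∈ xs → y ∈ xs →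
  x ≡ y ⊎ R x y ⊎ R y x
AllPairs-∈ (_ ∷ _)      (here refl) (here refl) = inj₁ refl
AllPairs-∈ (Rx ∷ _)     (here refl) (there y∈) = inj₂ (inj₁ (All.lookup Rx y∈))
AllPairs-∈ (Ry ∷ _)     (there x∈)  (here refl) = inj₂ (inj₂ (All.lookup Ry x∈))
AllPairs-∈ (_ ∷ pairs)  (there x∈)  (there y∈) = AllPairs-∈ pairs x∈ y∈

AllPairs-tabulate : ∀ {a r} {A : Set a} {R : A → A → Set r} xs → (∀ {x y} → x ∈ xs → y ∈ xs → R x y) →
  AllPairs R xs
AllPairs-tabulate []       R = []
AllPairs-tabulate (x ∷ xs) R =
  All.tabulate (R (here refl) ∘ there) ∷ AllPairs-tabulate xs (λ x∈ y∈ → R (there x∈) (there y∈))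

AllPairs-map-within : ∀ {a b p r s} {A : Set a} {B : Set b} {P : A → Set p} {R : A → A → Set r}
  {S : B → B → Set s} (g : A → B) → (∀ {x y} → P x → P y → R x y → S (g x) (g y)) →
  ∀ {xs} → All P xs → AllPairs R xs → AllPairs S (map g xs)
AllPairs-map-within g pres []         []         = []
AllPairs-map-within g pres (px ∷ pxs) (Rx ∷ Rxs) =
  All.map⁺ (All.zipWith (λ (py , Rxy) → pres px py Rxy) (pxs , Rx)) ∷ AllPairs-map-within g pres pxs Rxs

AllPairs-∷ʳ⁻ : ∀ {a r} {A : Set a} {R : A → A → Set r} xs {z} → AllPairs R (xs ∷ʳ z) →
  AllPairs R xs × All (λ x → R x z) xs
AllPairs-∷ʳ⁻ []       _          = [] , []
AllPairs-∷ʳ⁻ (x ∷ xs) (Rx ∷ Rxs) =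
  let Rxs′ , R-z = AllPairs-∷ʳ⁻ xs Rxs ; Rx′ , Rxz = All.∷ʳ⁻ Rx in Rx′ ∷ Rxs′ , Rxz ∷ R-z

AllPairs-∷ʳ⁺ : ∀ {a r} {A : Set a} {R : A → A → Set r} {xs z} → AllPairs R xs → All (λ x → R x z) xs →
  AllPairs R (xs ∷ʳ z)
AllPairs-∷ʳ⁺ Rxs R-z = AllPairs.++⁺ Rxs ([] ∷ []) (All.map (_∷ []) R-z)

fibre : ∀ {a n} {A : Set a} → (A → Subset n) → List A → Subset n → List A
fibre key xs X = filter (λ x → key x ≟ˢ X) xs

length-∷-fibre : ∀ {a n} {A : Set a} (key : A → Subset n) x xs X →
  length (fibre key (x ∷ xs) X) ≡ 𝟙 (does (key x ≟ˢ X)) + length (fibre key xs X)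
length-∷-fibre key x xs X with does (key x ≟ˢ X)
... | true  = refl
... | false = refl

length-fibre≡0 : ∀ {a n} {A : Set a} (key : A → Subset n) xs X → All (λ x → key x ≢ X) xs →
  length (fibre key xs X) ≡ 0
length-fibre≡0 key xs X none = cong length (filter-none (λ x → key x ≟ˢ X) none)

length≡∑-fibres : ∀ {a} {A : Set a} n (key : A → Subset n) xs → length xs ≡ ∑ n (length ∘ fibre key xs)
length≡∑-fibres n key []       = sym (∑-zero n)
length≡∑-fibres n key (x ∷ xs) = begin
  suc (length xs)                                                 ≡⟨ cong suc (length≡∑-fibres n key xs) ⟩
  1 + ∑ n (length ∘ fibre key xs)                                 ≡⟨ cong (_+ _) (∑-point n (key x)) ⟨
  ∑ n (λ X → 𝟙 (does (key x ≟ˢ X))) + ∑ n (length ∘ fibre key xs) ≡⟨ ∑-+ n _ _ ⟨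
  ∑ n (λ X → 𝟙 (does (key x ≟ˢ X)) + length (fibre key xs X))
    ≡⟨ ∑-cong n (sym ∘ length-∷-fibre key x xs) ⟩
  ∑ n (length ∘ fibre key (x ∷ xs))                               ∎
  where open ≡-Reasoning

-- Subsets of a subset X of [n], identified with subsets of [∣ X ∣]

expand : ∀ {n} (X : Subset n) → Subset ∣ X ∣ → Subset n
expand []            []      = []
expand (outside ∷ X) Y       = outside ∷ expand X Y
expand (inside ∷ X)  (y ∷ Y) = y ∷ expand X Y

compress : ∀ {n} (X : Subset n) → Subset n → Subset ∣ X ∣
compress []            []      = []
compress (outside ∷ X) (_ ∷ Y) = compress X Y
compress (inside ∷ X)  (y ∷ Y) = y ∷ compress X Y

compress-expand : ∀ {n} (X : Subset n) Y → compress X (expand X Y) ≡ Y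
compress-expand []            []      = refl
compress-expand (outside ∷ X) Y       = compress-expand X Y
compress-expand (inside ∷ X)  (y ∷ Y) = cong (y ∷_) (compress-expand X Y)

expand-compress : ∀ {n} (X Y : Subset n) → Y ⊆ X → expand X (compress X Y) ≡ Y
expand-compress []            []            _   = refl
expand-compress (outside ∷ X) (outside ∷ Y) Y⊆X = cong (outside ∷_) (expand-compress X Y (drop-∷-⊆ Y⊆X))
expand-compress (outside ∷ X) (inside ∷ Y)  Y⊆X with () ← Y⊆X here
expand-compress (inside ∷ X)  (y ∷ Y)       Y⊆X = cong (y ∷_) (expand-compress X Y (drop-∷-⊆ Y⊆X))

expand-injective : ∀ {n} (X : Subset n) {Y Z} → expand X Y ≡ expand X Z → Y ≡ Z
expand-injective X {Y} {Z} eq =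
  trans (sym (compress-expand X Y)) (trans (cong (compress X) eq) (compress-expand X Z))

∣expand∣ : ∀ {n} (X : Subset n) Y → ∣ expand X Y ∣ ≡ ∣ Y ∣
∣expand∣ []            []            = refl
∣expand∣ (outside ∷ X) Y             = ∣expand∣ X Y
∣expand∣ (inside ∷ X)  (inside ∷ Y)  = cong suc (∣expand∣ X Y)
∣expand∣ (inside ∷ X)  (outside ∷ Y) = ∣expand∣ X Y

∣compress∣ : ∀ {n} (X Y : Subset n) → Y ⊆ X → ∣ compress X Y ∣ ≡ ∣ Y ∣
∣compress∣ X Y Y⊆X = trans (sym (∣expand∣ X (compress X Y))) (cong ∣_∣ (expand-compress X Y Y⊆X))

expand-⊤ : ∀ {n} (X : Subset n) → expand X ⊤ ≡ X
expand-⊤ []            = refl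
expand-⊤ (outside ∷ X) = cong (outside ∷_) (expand-⊤ X)
expand-⊤ (inside ∷ X)  = cong (inside ∷_) (expand-⊤ X)

expand-mono-⊆ : ∀ {n} (X : Subset n) {Y Z} → Y ⊆ Z → expand X Y ⊆ expand X Z
expand-mono-⊆ []            {[]}          {[]}    Y⊆Z = Y⊆Z
expand-mono-⊆ (outside ∷ X)                       Y⊆Z = out⊆ (expand-mono-⊆ X Y⊆Z)
expand-mono-⊆ (inside ∷ X)  {outside ∷ Y} {_ ∷ Z} Y⊆Z = out⊆ (expand-mono-⊆ X (drop-∷-⊆ Y⊆Z))
expand-mono-⊆ (inside ∷ X)  {inside ∷ Y}  {z ∷ Z} Y⊆Z with z | Y⊆Z here
... | inside | _ = in⊆in (expand-mono-⊆ X (drop-∷-⊆ Y⊆Z))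

compress-mono-⊆ : ∀ {n} (X : Subset n) {Y Z} → Y ⊆ Z → compress X Y ⊆ compress X Z
compress-mono-⊆ []            {[]}          {[]}    Y⊆Z = Y⊆Z
compress-mono-⊆ (outside ∷ X) {_ ∷ Y}       {_ ∷ Z} Y⊆Z = compress-mono-⊆ X (drop-∷-⊆ Y⊆Z)
compress-mono-⊆ (inside ∷ X)  {outside ∷ Y} {_ ∷ Z} Y⊆Z = out⊆ (compress-mono-⊆ X (drop-∷-⊆ Y⊆Z))
compress-mono-⊆ (inside ∷ X)  {inside ∷ Y}  {z ∷ Z} Y⊆Z with z | Y⊆Z here
... | inside | _ = in⊆in (compress-mono-⊆ X (drop-∷-⊆ Y⊆Z))

expand-mono-⊂ : ∀ {n} (X : Subset n) {Y Z} → Y ⊂ Z → expand X Y ⊂ expand X Z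
expand-mono-⊂ X Y⊂Z = ⊆∧≢⇒⊂ (expand-mono-⊆ X (p⊂q⇒p⊆q Y⊂Z)) (⊂⇒≢ Y⊂Z ∘ expand-injective X)

compress-mono-⊂ : ∀ {n} (X : Subset n) {Y Z} → Y ⊆ X → Z ⊆ X → Y ⊂ Z → compress X Y ⊂ compress X Z
compress-mono-⊂ X {Y} {Z} Y⊆X Z⊆X Y⊂Z = ⊆∧≢⇒⊂ (compress-mono-⊆ X (p⊂q⇒p⊆q Y⊂Z)) λ eq →
  ⊂⇒≢ Y⊂Z (trans (sym (expand-compress X Y Y⊆X)) (trans (cong (expand X) eq) (expand-compress X Z Z⊆X)))

-- Flags as increasing lists

-- The largest member of a flag; ⊥ is a junk value for the empty flag.
top : ∀ {n} → List (Subset n) → Subset n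
top []          = ⊥
top (X ∷ [])    = X
top (_ ∷ Y ∷ f) = top (Y ∷ f)

init : ∀ {a} {A : Set a} → List A → List A
init []          = []
init (_ ∷ [])    = []
init (X ∷ Y ∷ f) = X ∷ init (Y ∷ f)

top-∷ʳ : ∀ {n} (f : List (Subset n)) X → top (f ∷ʳ X) ≡ X
top-∷ʳ []          X = refl
top-∷ʳ (_ ∷ [])    X = refl
top-∷ʳ (_ ∷ Y ∷ f) X = top-∷ʳ (Y ∷ f) X

init-∷ʳ : ∀ {a} {A : Set a} (f : List A) X → init (f ∷ʳ X) ≡ f
init-∷ʳ []          X = refl
init-∷ʳ (_ ∷ [])    X = refl
init-∷ʳ (Y ∷ Z ∷ f) X = cong (Y ∷_) (init-∷ʳ (Z ∷ f) X)

init-∷ʳ-top : ∀ {n} (f : List (Subset n)) → f ≢ [] → init f ∷ʳ top f ≡ f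
init-∷ʳ-top []          f≢[] = ⊥-elim (f≢[] refl)
init-∷ʳ-top (_ ∷ [])    _    = refl
init-∷ʳ-top (X ∷ Y ∷ f) _    = cong (X ∷_) (init-∷ʳ-top (Y ∷ f) λ ())

top∈ : ∀ {n} (f : List (Subset n)) → f ≢ [] → top f ∈ f
top∈ f f≢[] = subst (top f ∈_) (init-∷ʳ-top f f≢[]) (∈-++⁺ʳ (init f) (here refl))

⊆top : ∀ {n} {f : List (Subset n)} → Linked _⊂_ f → All (_⊆ top f) f
⊆top []                = []
⊆top [-]               = ⊆-refl ∷ []
⊆top (Y⊂Z ∷ chain@(_ ∷ _)) with Z⊆top ∷ rest ← ⊆top chain = ⊆-trans (p⊂q⇒p⊆q Y⊂Z) Z⊆top ∷ Z⊆top ∷ rest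
⊆top (Y⊂Z ∷ [-])       = p⊂q⇒p⊆q Y⊂Z ∷ ⊆-refl ∷ []

init⊂top : ∀ {n} {f : List (Subset n)} → Linked _⊂_ f → AllPairs _⊂_ (init f) × All (_⊂ top f) (init f)
init⊂top {f = []}    _     = [] , []
init⊂top {f = _ ∷ f} chain =
  AllPairs-∷ʳ⁻ (init (_ ∷ f))
    (subst (AllPairs _⊂_) (sym (init-∷ʳ-top (_ ∷ f) λ ())) (Linked⇒AllPairs ⊂-trans chain))

∈-remove⁺ : ∀ {k t T} → k ∈ T → k ≢ t → k ∈ remove t T
∈-remove⁺ {t = t} {T} = ∈-filter⁺ (λ k → ¬? (k ≟ t)) {xs = T}

∈-remove⁻ : ∀ {k t} T → k ∈ remove t T → k ∈ T × k ≢ t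
∈-remove⁻ {t = t} T = ∈-filter⁻ (λ k → ¬? (k ≟ t)) {xs = T}

vertex-≢[] : ∀ {n T k} {f : List (Subset n)} → k ∈ T → IsVertex n T f → f ≢ []
vertex-≢[] k∈T (_ , type) refl with () ← Equivalence.to (type _) k∈T

∣top∣≡max : ∀ {n T t} {f : List (Subset n)} → t ∈ T → All (_≤ t) T → IsVertex n T f → ∣ top f ∣ ≡ t
∣top∣≡max {T = T} {t} {f} t∈T ≤t v@((_ , chain) , type) = ≤-antisym ∣top∣≤t t≤∣top∣
  where
  ∣top∣≤t : ∣ top f ∣ ≤ t
  ∣top∣≤t = All.lookup ≤t (Equivalence.from (type _) (lose (top∈ f (vertex-≢[] t∈T v)) refl))
  t≤∣top∣ : t ≤ ∣ top f ∣
  t≤∣top∣ with Y , Y∈f , ∣Y∣≡t ← find (Equivalence.to (type t) t∈T) =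
    subst (_≤ ∣ top f ∣) ∣Y∣≡t (p⊆q⇒∣p∣≤∣q∣ (All.lookup (⊆top chain) Y∈f))

restrict : ∀ {n} (X : Subset n) → List (Subset n) → List (Subset ∣ X ∣)
restrict X f = map (compress X) (init f)

extend : ∀ {n} (X : Subset n) → List (Subset ∣ X ∣) → List (Subset n)
extend X g = map (expand X) g ∷ʳ X

top-extend : ∀ {n} (X : Subset n) g → top (extend X g) ≡ X
top-extend X g = top-∷ʳ (map (expand X) g) X

restrict-extend : ∀ {n} (X : Subset n) g → restrict X (extend X g) ≡ g
restrict-extend X g = begin
  map (compress X) (init (map (expand X) g ∷ʳ X))  ≡⟨ cong (map (compress X)) (init-∷ʳ (map (expand X) g) X) ⟩
  map (compress X) (map (expand X) g)              ≡⟨ map-∘ g ⟨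
  map (compress X ∘ expand X) g                    ≡⟨ map-cong (compress-expand X) g ⟩
  map id g                                         ≡⟨ map-id g ⟩
  g                                                ∎
  where open ≡-Reasoning

extend-restrict : ∀ {n} (f : List (Subset n)) → Linked _⊂_ f → f ≢ [] →
  extend (top f) (restrict (top f) f) ≡ f
extend-restrict {n} f chain f≢[] = begin
  map (expand X) (map (compress X) (init f)) ∷ʳ X  ≡⟨ cong (_∷ʳ X) (map-∘ (init f)) ⟨
  map (expand X ∘ compress X) (init f) ∷ʳ X        ≡⟨ cong (_∷ʳ X) (map-id-local expand-compress-init) ⟩
  init f ∷ʳ X                                      ≡⟨ init-∷ʳ-top f f≢[] ⟩
  f                                                ∎
  where
  open ≡-Reasoning
  X : Subset n
  X = top f
  expand-compress-init : All (λ Y → expand X (compress X Y) ≡ Y) (init f)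
  expand-compress-init = All.map (λ Y⊂X → expand-compress X _ (p⊂q⇒p⊆q Y⊂X)) (proj₂ (init⊂top chain))

restrict-vertex : ∀ {n T} (f : List (Subset n)) X → top f ≡ X → f ≢ [] → IsVertex n T f →
  IsVertex ∣ X ∣ (remove ∣ X ∣ T) (restrict X f)
restrict-vertex {n} {T} f .(top f) refl f≢[] ((proper , chain) , type) =
  (All.map⁺ (All.tabulate proper′) , AllPairs⇒Linked chain′) , λ k → mk⇔ (to k) (from k)
  where
  X : Subset n
  X = top f
  B : List (Subset n)
  B = init f
  B⊂X : All (_⊂ X) B
  B⊂X = proj₂ (init⊂top chain)
  B⊆f : ∀ {Y} → Y ∈ B → Y ∈ f
  B⊆f Y∈B = subst (_ ∈_) (init-∷ʳ-top f f≢[]) (∈-++⁺ˡ Y∈B)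
  ∣compress∣-B : ∀ {Y} → Y ∈ B → ∣ compress X Y ∣ ≡ ∣ Y ∣
  ∣compress∣-B Y∈B = ∣compress∣ X _ (p⊂q⇒p⊆q (All.lookup B⊂X Y∈B))
  proper′ : ∀ {Y} → Y ∈ B → NonEmptyProper (compress X Y)
  proper′ Y∈B = ∣∣⇒NonEmptyProper _
    (subst (0 <_) (sym (∣compress∣-B Y∈B)) (proj₁ (NonEmptyProper⇒∣∣ (All.lookup proper (B⊆f Y∈B)))))
    (subst (_< ∣ X ∣) (sym (∣compress∣-B Y∈B)) (p⊂q⇒∣p∣<∣q∣ (All.lookup B⊂X Y∈B)))
  chain′ : AllPairs _⊂_ (map (compress X) B)
  chain′ = AllPairs-map-within (compress X) (λ Y⊂X Z⊂X → compress-mono-⊂ X (p⊂q⇒p⊆q Y⊂X) (p⊂q⇒p⊆q Z⊂X))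
    B⊂X (proj₁ (init⊂top chain))
  to : ∀ k → k ∈ remove ∣ X ∣ T → Any (λ Z → ∣ Z ∣ ≡ k) (map (compress X) B)
  to k k∈T′ with k∈T , k≢∣X∣ ← ∈-remove⁻ T k∈T′
            with Y , Y∈f , ∣Y∣≡k ← find (Equivalence.to (type k) k∈T)
            with ∈-++⁻ B (subst (Y ∈_) (sym (init-∷ʳ-top f f≢[])) Y∈f)
  ... | inj₁ Y∈B         = lose (∈-map⁺ (compress X) Y∈B) (trans (∣compress∣-B Y∈B) ∣Y∣≡k)
  ... | inj₂ (here refl) = ⊥-elim (k≢∣X∣ (sym ∣Y∣≡k))
  from : ∀ k → Any (λ Z → ∣ Z ∣ ≡ k) (map (compress X) B) → k ∈ remove ∣ X ∣ T
  from k Z∈ with Z , Z∈B′ , ∣Z∣≡k ← find Z∈ with Y , Y∈B , refl ← ∈-map⁻ (compress X) Z∈B′ =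
    ∈-remove⁺ (Equivalence.from (type k) (lose (B⊆f Y∈B) ∣Y∣≡k)) λ k≡∣X∣ →
      <-irrefl (trans ∣Y∣≡k k≡∣X∣) (p⊂q⇒∣p∣<∣q∣ (All.lookup B⊂X Y∈B))
    where
    ∣Y∣≡k : ∣ Y ∣ ≡ k
    ∣Y∣≡k = trans (sym (∣compress∣-B Y∈B)) ∣Z∣≡k

extend-vertex : ∀ {n T} (X : Subset n) g → ∣ X ∣ ∈ T → 0 < ∣ X ∣ → ∣ X ∣ < n →
  IsVertex ∣ X ∣ (remove ∣ X ∣ T) g → IsVertex n T (extend X g)
extend-vertex {n} {T} X g ∣X∣∈T 0<∣X∣ ∣X∣<n ((proper , chain) , type) =
  (All.∷ʳ⁺ (All.map⁺ (All.map proper′ proper)) (∣∣⇒NonEmptyProper X 0<∣X∣ ∣X∣<n) , AllPairs⇒Linked chain′) ,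
  λ k → mk⇔ (to k) (from k)
  where
  G : List (Subset n)
  G = map (expand X) g
  proper′ : ∀ {Z} → NonEmptyProper Z → NonEmptyProper (expand X Z)
  proper′ {Z} Z-proper = let 0<∣Z∣ , ∣Z∣<∣X∣ = NonEmptyProper⇒∣∣ Z-proper in
    ∣∣⇒NonEmptyProper _ (subst (0 <_) (sym (∣expand∣ X Z)) 0<∣Z∣)
      (<-trans (subst (_< ∣ X ∣) (sym (∣expand∣ X Z)) ∣Z∣<∣X∣) ∣X∣<n)
  ⊂X : ∀ {Z} → NonEmptyProper Z → expand X Z ⊂ X
  ⊂X {Z} (_ , Z≢⊤) = subst (expand X Z ⊂_) (expand-⊤ X) (expand-mono-⊂ X (⊆∧≢⇒⊂ ⊆⊤ Z≢⊤))
  chain′ : AllPairs _⊂_ (G ∷ʳ X)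
  chain′ = AllPairs-∷ʳ⁺ (AllPairs.map⁺ (AllPairs.map (expand-mono-⊂ X) (Linked⇒AllPairs ⊂-trans chain)))
                        (All.map⁺ (All.map ⊂X proper))
  to : ∀ k → k ∈ T → Any (λ Z → ∣ Z ∣ ≡ k) (G ∷ʳ X)
  to k k∈T with k ≟ ∣ X ∣
  ... | yes refl = lose (∈-++⁺ʳ G (here refl)) refl
  ... | no k≢∣X∣ with Z , Z∈g , ∣Z∣≡k ← find (Equivalence.to (type k) (∈-remove⁺ k∈T k≢∣X∣)) =
    lose (∈-++⁺ˡ (∈-map⁺ (expand X) Z∈g)) (trans (∣expand∣ X Z) ∣Z∣≡k)
  from : ∀ k → Any (λ Z → ∣ Z ∣ ≡ k) (G ∷ʳ X) → k ∈ T
  from k Z∈ with Z , Z∈G∷ʳX , ∣Z∣≡k ← find Z∈ with ∈-++⁻ G Z∈G∷ʳX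
  ... | inj₂ (here refl) = subst (_∈ T) ∣Z∣≡k ∣X∣∈T
  ... | inj₁ Z∈G with Y , Y∈g , refl ← ∈-map⁻ (expand X) Z∈G =
    proj₁ (∈-remove⁻ T (Equivalence.from (type k) (lose Y∈g (trans (sym (∣expand∣ X Y)) ∣Z∣≡k))))

-- Enumerating the vertices of Γ(n, T)

subsets : ∀ n → List (Subset n)
subsets zero    = [ [] ]
subsets (suc n) = cartesianProductWith _∷_ (outside ∷ inside ∷ []) (subsets n)

∈-subsets : ∀ {n} (X : Subset n) → X ∈ subsets n
∈-subsets []            = here refl
∈-subsets (outside ∷ X) = ∈-cartesianProductWith⁺ _∷_ {xs = outside ∷ inside ∷ []} (here refl) (∈-subsets X)
∈-subsets (inside ∷ X)  =
  ∈-cartesianProductWith⁺ _∷_ {xs = outside ∷ inside ∷ []} (there (here refl)) (∈-subsets X)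

lists : ∀ {a} {A : Set a} → List A → ℕ → List (List A)
lists xs zero    = [ [] ]
lists xs (suc b) = [] ∷ cartesianProductWith _∷_ xs (lists xs b)

∈-lists : ∀ {a} {A : Set a} {xs : List A} {ys} b → All (_∈ xs) ys → length ys ≤ b → ys ∈ lists xs b
∈-lists zero    []               _             = here refl
∈-lists (suc b) []               _             = here refl
∈-lists (suc b) (y∈xs ∷ ys⊆xs) (s≤s len≤b) = there (∈-cartesianProductWith⁺ _∷_ y∈xs (∈-lists b ys⊆xs len≤b))

length-chain : ∀ {n} {X : Subset n} {f} → Linked _⊂_ (X ∷ f) → length f + ∣ X ∣ ≤ n
length-chain {X = X} [-]                 = ∣p∣≤n X
length-chain {X = X} {Y ∷ f} (X⊂Y ∷ chain) = begin
  suc (length f) + ∣ X ∣ ≡⟨ +-suc (length f) ∣ X ∣ ⟨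
  length f + suc ∣ X ∣  ≤⟨ +-monoʳ-≤ (length f) (p⊂q⇒∣p∣<∣q∣ X⊂Y) ⟩
  length f + ∣ Y ∣      ≤⟨ length-chain chain ⟩
  _                     ∎
  where open ≤-Reasoning

length-flag : ∀ {n} {f : List (Subset n)} → Linked _⊂_ f → length f ≤ suc n
length-flag []                  = z≤n
length-flag {f = X ∷ f} chain = s≤s (≤-trans (m≤m+n (length f) ∣ X ∣) (length-chain chain))

HasType⇔ : ∀ {n} (f : List (Subset n)) T →
  (All (λ k → Any (λ X → ∣ X ∣ ≡ k) f) T × All (λ X → ∣ X ∣ ∈ T) f) ⇔ HasType f T
HasType⇔ f T = mk⇔
  (λ (covered , sizes) k → mk⇔ (All.lookup covered)
    λ X∈ → let X , X∈f , ∣X∣≡k = find X∈ in subst (_∈ T) ∣X∣≡k (All.lookup sizes X∈f))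
  (λ type → All.tabulate (Equivalence.to (type _)) ,
            All.tabulate (λ X∈f → Equivalence.from (type _) (lose X∈f refl)))

isVertex? : ∀ n T → Decidable (IsVertex n T)
isVertex? n T f =
  (All.all? (λ X → nonempty? X ×-dec ¬? (X ≟ˢ ⊤)) f ×-dec linked? _⊂?_ f) ×-dec
  Dec.map (HasType⇔ f T) (All.all? (λ k → Any.any? (λ X → ∣ X ∣ ≟ k) f) T ×-dec All.all? (λ X → ∣ X ∣ ∈? T) f)

_≟ᶠˡ_ : ∀ {n} → DecidableEquality (List (Subset n))
_≟ᶠˡ_ = List.≡-dec _≟ˢ_

vertices : ∀ n → List ℕ → List (List (Subset n))
vertices n T = filter (isVertex? n T) (deduplicate _≟ᶠˡ_ (lists (subsets n) (suc n)))

vertices-unique : ∀ n T → Unique (vertices n T)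
vertices-unique n T = Unique.filter⁺ (isVertex? n T) (deduplicate-! _≟ᶠˡ_ (lists (subsets n) (suc n)))

∈-vertices⁻ : ∀ {n T f} → f ∈ vertices n T → IsVertex n T f
∈-vertices⁻ {n} {T} f∈ =
  proj₂ (∈-filter⁻ (isVertex? n T) {xs = deduplicate _≟ᶠˡ_ (lists (subsets n) (suc n))} f∈)

∈-vertices⁺ : ∀ {n T f} → IsVertex n T f → f ∈ vertices n T
∈-vertices⁺ {n} {T} {f} v@((_ , chain) , _) = ∈-filter⁺ (isVertex? n T)
  (∈-deduplicate⁺ _≟ᶠˡ_ (∈-lists (suc n) (All.tabulate (λ {X} _ → ∈-subsets X)) (length-flag chain))) v

vertexCount : ∀ n T → VertexCountIs n T (length (vertices n T))
vertexCount n T = vertices n T , vertices-unique n T , All.tabulate ∈-vertices⁻ , (λ _ → ∈-vertices⁺) , refl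

meets? : ∀ {n} (A B : Subset n) → Dec (Meets A B)
meets? A B = any? (λ i → (lookup A i Bool.≟ inside) ×-dec (lookup B i Bool.≟ inside))

meets-self : ∀ {n} {X : Subset n} → Nonempty X → Meets X X
meets-self (i , i∈X) = i , []=⇒lookup i∈X , []=⇒lookup i∈X

¬Meets⇒∩≡⊥ : ∀ {n} {A B : Subset n} → ¬ Meets A B → A ∩ B ≡ ⊥
¬Meets⇒∩≡⊥ {A = A} {B} ¬meets = Empty-unique λ (i , i∈A∩B) →
  let i∈A , i∈B = x∈p∩q⁻ A B i∈A∩B in ¬meets (i , []=⇒lookup i∈A , []=⇒lookup i∈B)

disjoint-tops⇒GenPos : ∀ {n} {f g : List (Subset n)} → Linked _⊂_ f → Linked _⊂_ g →
  ¬ Meets (top f) (top g) → GenPos f g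
disjoint-tops⇒GenPos chain-f chain-g ¬meets =
  All.tabulate λ Z∈f → All.tabulate λ W∈g →
    inj₂ (¬Meets⇒∩≡⊥ (¬meets ∘ widen (All.lookup (⊆top chain-f) Z∈f) (All.lookup (⊆top chain-g) W∈g)))
  where
  widen : ∀ {n} {Z W X Y : Subset n} → Z ⊆ X → W ⊆ Y → Meets Z W → Meets X Y
  widen {Z = Z} {W} Z⊆X W⊆Y (i , i∈Z , i∈W) =
    i , []=⇒lookup (Z⊆X (lookup⇒[]= i Z i∈Z)) , []=⇒lookup (W⊆Y (lookup⇒[]= i W i∈W))

fibre-≤-vertices : ∀ {n T} (I : List (List (Subset n))) X → Unique I → All (IsVertex n T) I → 0 < ∣ X ∣ →
  length (fibre top I X) ≤ length (vertices ∣ X ∣ (remove ∣ X ∣ T))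
fibre-≤-vertices {n} {T} I X unique vs 0<∣X∣ =
  length-≤-injection (restrict X) (Unique.filter⁺ (λ f → top f ≟ˢ X) unique) restrict∈ restrict-injective
  where
  info : ∀ {f} → f ∈ fibre top I X → IsVertex n T f × top f ≡ X × f ≢ []
  info {f} f∈ with f∈I , top≡X ← ∈-filter⁻ (λ f → top f ≟ˢ X) {xs = I} f∈ =
    All.lookup vs f∈I , top≡X , λ { refl → <-irrefl (sym (trans (cong ∣_∣ (sym top≡X)) (∣⊥∣≡0 n))) 0<∣X∣ }
  restrict∈ : ∀ {f} → f ∈ fibre top I X → restrict X f ∈ vertices ∣ X ∣ (remove ∣ X ∣ T)
  restrict∈ {f} f∈ with v , top≡X , f≢[] ← info f∈ = ∈-vertices⁺ (restrict-vertex f X top≡X f≢[] v)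
  restrict-injective : ∀ {f g} → f ∈ fibre top I X → g ∈ fibre top I X → restrict X f ≡ restrict X g → f ≡ g
  restrict-injective {f} {g} f∈ g∈ eq
    with ((_ , chain-f) , _) , refl , f≢[] ← info f∈ | ((_ , chain-g) , _) , top≡ , g≢[] ← info g∈ = begin
      f                                   ≡⟨ extend-restrict f chain-f f≢[] ⟨
      extend (top f) (restrict (top f) f) ≡⟨ cong (extend (top f)) eq ⟩
      extend (top f) (restrict (top f) g)
        ≡⟨ subst (λ X → extend X (restrict X g) ≡ g) top≡ (extend-restrict g chain-g g≢[]) ⟩
      g                                   ∎
    where open ≡-Reasoning

vertices-≤-fibre : ∀ {n T} (I : List (List (Subset n))) X → (∀ {f} → IsVertex n T f → top f ≡ X → f ∈ I) →
  ∣ X ∣ ∈ T → 0 < ∣ X ∣ → ∣ X ∣ < n → length (vertices ∣ X ∣ (remove ∣ X ∣ T)) ≤ length (fibre top I X)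
vertices-≤-fibre {n} {T} I X I-complete ∣X∣∈T 0<∣X∣ ∣X∣<n =
  length-≤-injection (extend X) (vertices-unique ∣ X ∣ (remove ∣ X ∣ T)) extend∈ extend-injective
  where
  extend∈ : ∀ {g} → g ∈ vertices ∣ X ∣ (remove ∣ X ∣ T) → extend X g ∈ fibre top I X
  extend∈ {g} g∈ = ∈-filter⁺ (λ f → top f ≟ˢ X) {xs = I}
    (I-complete (extend-vertex X g ∣X∣∈T 0<∣X∣ ∣X∣<n (∈-vertices⁻ g∈)) (top-extend X g)) (top-extend X g)
  extend-injective : ∀ {g h} → _ → _ → extend X g ≡ extend X h → g ≡ h
  extend-injective {g} {h} _ _ eq =
    trans (sym (restrict-extend X g)) (trans (cong (restrict X) eq) (restrict-extend X h))

module Bounds {m s : ℕ} {T : List ℕ} (t∈T : suc s ∈ T) (≤t : All (_≤ suc s) T) (2t≤n : 2 * suc s ≤ suc m)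
  where

  c : ℕ
  c = length (vertices (suc s) (remove (suc s) T))

  t<n : suc s < suc m
  t<n = <-≤-trans (m<m+n (suc s) (s≤s z≤n)) (subst (_≤ suc m) (cong (suc s +_) (+-identityʳ (suc s))) 2t≤n)

  ∣top∣≡t : ∀ {f} → IsVertex (suc m) T f → ∣ top f ∣ ≡ suc s
  ∣top∣≡t = ∣top∣≡max t∈T ≤t

  length-vertices-at : ∀ (X : Subset (suc m)) → ∣ X ∣ ≡ suc s → length (vertices ∣ X ∣ (remove ∣ X ∣ T)) ≡ c
  length-vertices-at X = cong (λ k → length (vertices k (remove k T)))

  fibre-≤-c : ∀ I X → Unique I → All (IsVertex (suc m) T) I → ∣ X ∣ ≡ suc s → length (fibre top I X) ≤ c
  fibre-≤-c I X unique vs ∣X∣≡t = ≤-trans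
    (fibre-≤-vertices I X unique vs (subst (0 <_) (sym ∣X∣≡t) (s≤s z≤n)))
    (≤-reflexive (length-vertices-at X ∣X∣≡t))

  c-≤-fibre : ∀ I X → (∀ {f} → IsVertex (suc m) T f → top f ≡ X → f ∈ I) → ∣ X ∣ ≡ suc s →
    c ≤ length (fibre top I X)
  c-≤-fibre I X complete ∣X∣≡t = ≤-trans (≤-reflexive (sym (length-vertices-at X ∣X∣≡t)))
    (vertices-≤-fibre I X complete (subst (_∈ T) (sym ∣X∣≡t) t∈T) (subst (0 <_) (sym ∣X∣≡t) (s≤s z≤n))
      (subst (_< suc m) (sym ∣X∣≡t) t<n))

  independent-≤ : ∀ I → IsIndependent (suc m) T I → length I ≤ (m C s) * c
  independent-≤ I (unique , vs , independent) = begin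
    length I                          ≡⟨ length≡∑-fibres (suc m) top I ⟩
    ∑ (suc m) (length ∘ fibre top I)  ≤⟨ ∑-mono-≤ (suc m) fibre≤ ⟩
    ∑ (suc m) (λ X → 𝟙 (tops X) * c)  ≡⟨ ∑-*ʳ (suc m) (𝟙 ∘ tops) c ⟩
    size tops * c                     ≤⟨ *-monoˡ-≤ c (erdősKoRado m s tops tops-uniform tops-intersecting 2t≤n) ⟩
    (m C s) * c                       ∎
    where
    open ≤-Reasoning
    tops : Family (suc m)
    tops X = does (Any.any? (λ f → top f ≟ˢ X) I)
    top-witness : ∀ {X} → tops X ≡ true → ∃ λ f → f ∈ I × top f ≡ X
    top-witness {X} tX with Any.any? (λ f → top f ≟ˢ X) I
    ... | yes f∈ = find f∈
    fibre≤ : ∀ X → length (fibre top I X) ≤ 𝟙 (tops X) * c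
    fibre≤ X with Any.any? (λ f → top f ≟ˢ X) I
    ... | yes f∈ with f , f∈I , refl ← find f∈ =
      ≤-trans (fibre-≤-c I (top f) unique vs (∣top∣≡t (All.lookup vs f∈I)))
              (≤-reflexive (sym (+-identityʳ c)))
    ... | no none = ≤-reflexive (length-fibre≡0 top I X (All.tabulate λ f∈I → none ∘ lose f∈I))
    tops-uniform : Uniform tops (suc s)
    tops-uniform X tX with f , f∈I , refl ← top-witness tX = ∣top∣≡t (All.lookup vs f∈I)
    tops-intersecting : Intersecting tops
    tops-intersecting A B tA tB with f , f∈I , refl ← top-witness tA | g , g∈I , refl ← top-witness tB
                                with meets? (top f) (top g)
    ... | yes meets = meets
    ... | no ¬meets with All.lookup vs f∈I | All.lookup vs g∈I | AllPairs-∈ independent f∈I g∈I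
    ...   | ((proper , _) , _) | _ | inj₁ refl =
      ⊥-elim (¬meets (meets-self (proj₁ (All.lookup proper (top∈ f (vertex-≢[] t∈T (All.lookup vs f∈I)))))))
    ...   | ((_ , chain-f) , _) | ((_ , chain-g) , _) | inj₂ (inj₁ ¬gp) =
      ⊥-elim (¬gp (disjoint-tops⇒GenPos chain-f chain-g ¬meets))
    ...   | ((_ , chain-f) , _) | ((_ , chain-g) , _) | inj₂ (inj₂ ¬gp) =
      ⊥-elim (¬gp (disjoint-tops⇒GenPos chain-g chain-f (¬meets ∘ Meets-sym {A = top g} {B = top f})))

  star : List (List (Subset (suc m)))
  star = filter (λ f → lookup (top f) zero Bool.≟ inside) (vertices (suc m) T)

  ∈-star⁻ : ∀ {f} → f ∈ star → IsVertex (suc m) T f × lookup (top f) zero ≡ inside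
  ∈-star⁻ f∈ = Product.map₁ ∈-vertices⁻
    (∈-filter⁻ (λ f → lookup (top f) zero Bool.≟ inside) {xs = vertices (suc m) T} f∈)

  ¬GenPosSet-through-0 : ∀ {A B : Subset (suc m)} → lookup A zero ≡ inside → lookup B zero ≡ inside →
    ∣ A ∣ ≡ suc s → ∣ B ∣ ≡ suc s → ¬ GenPosSet A B
  ¬GenPosSet-through-0 {inside ∷ A} {inside ∷ B} _ _ ∣A∣ ∣B∣ (inj₁ A∪B≡⊤) = <-irrefl
    (trans (cong ∣_∣ (∷-injectiveʳ A∪B≡⊤)) (∣⊤∣≡n m))
    (s≤s⁻¹ (≤-trans (2+∣p∪q∣≤2t A B (suc-injective ∣A∣) (suc-injective ∣B∣)) 2t≤n))

  star-independent : IsIndependent (suc m) T star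
  star-independent =
    Unique.filter⁺ (λ f → lookup (top f) zero Bool.≟ inside) (vertices-unique (suc m) T) ,
    All.tabulate (proj₁ ∘ ∈-star⁻) ,
    AllPairs-tabulate star λ f∈ g∈ gp →
      let vf , 0∈f = ∈-star⁻ f∈ ; vg , 0∈g = ∈-star⁻ g∈ in
      ¬GenPosSet-through-0 0∈f 0∈g (∣top∣≡t vf) (∣top∣≡t vg)
        (All.lookup (All.lookup gp (top∈ _ (vertex-≢[] t∈T vf))) (top∈ _ (vertex-≢[] t∈T vg)))

  fibre-star-outside : ∀ X → length (fibre top star (outside ∷ X)) ≡ 0
  fibre-star-outside X = length-fibre≡0 top star (outside ∷ X) (All.tabulate λ f∈ top≡ →
    case trans (sym (proj₂ (∈-star⁻ f∈))) (cong (λ Y → lookup Y zero) top≡) of λ ())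

  fibre-star-inside : ∀ X → length (fibre top star (inside ∷ X)) ≡ 𝟙 (does (∣ X ∣ ≟ s)) * c
  fibre-star-inside X = ≡𝟙[does]* (∣ X ∣ ≟ s)
    (λ ∣X∣≡s → ≤-antisym
      (fibre-≤-c star (inside ∷ X) (proj₁ star-independent) (proj₁ (proj₂ star-independent)) (cong suc ∣X∣≡s))
      (c-≤-fibre star (inside ∷ X) in-star (cong suc ∣X∣≡s)))
    (λ ∣X∣≢s → length-fibre≡0 top star (inside ∷ X) (All.tabulate λ f∈ top≡ →
      ∣X∣≢s (suc-injective (trans (cong ∣_∣ (sym top≡)) (∣top∣≡t (proj₁ (∈-star⁻ f∈)))))))
    where
    in-star : ∀ {f} → IsVertex (suc m) T f → top f ≡ inside ∷ X → f ∈ star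
    in-star v top≡ =
      ∈-filter⁺ (λ f → lookup (top f) zero Bool.≟ inside) (∈-vertices⁺ v) (cong (λ Y → lookup Y zero) top≡)

  length-star : length star ≡ (m C s) * c
  length-star = begin
    length star                                                     ≡⟨ length≡∑-fibres (suc m) top star ⟩
    ∑ m (length ∘ fibre top star ∘ (outside ∷_)) + ∑ m (length ∘ fibre top star ∘ (inside ∷_))
      ≡⟨ cong₂ _+_ (trans (∑-cong m fibre-star-outside) (∑-zero m)) (∑-cong m fibre-star-inside) ⟩
    ∑ m (λ X → 𝟙 (does (∣ X ∣ ≟ s)) * c)                                  ≡⟨ ∑-*ʳ m _ c ⟩
    ∑ m (λ X → 𝟙 (does (∣ X ∣ ≟ s))) * c                                  ≡⟨ cong (_* c) (∑-size m s) ⟩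
    (m C s) * c                                                     ∎
    where open ≡-Reasoning

mainTheorem5 : (n : ℕ) → 1 < n → (T : List ℕ) → T ≢ []
    → All (λ k → 1 ≤ k × k ≤ n ∸ 1) T
    → (t : ℕ) → t ∈ T → All (λ k → k ≤ t) T → t * 2 ≤ n
    → Σ ℕ (λ c → VertexCountIs t (remove t T) c
        × IndependenceNumberIs n T (((n ∸ 1) C (t ∸ 1)) * c))
mainTheorem5 zero    ()
mainTheorem5 (suc m) _  T _ bounds zero    t∈T _  _ with () ← proj₁ (All.lookup bounds t∈T)
mainTheorem5 (suc m) _  T _ _      (suc s) t∈T ≤t 2t≤n =
  c , vertexCount (suc s) (remove (suc s) T) , (star , star-independent , length-star) , independent-≤
  where open Bounds t∈T ≤t (subst (_≤ suc m) (*-comm (suc s) 2) 2t≤n)
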